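{- Consider the game $\mathcal{R}(K_{\aleph_0}, \hat{K}_{2,3})$ and suppose that, at some position in which it is $P_1$'s turn, $P_1$'s claimed edges contain a copy of $\hat{K}_{2,2}$, $P_2$ does not have a threat, and $P_2$ has claimed at most $7$ edges of the board. Then $P_1$ has a winning strategy from this position.
   Context: The Strong Ramsey game $\mathcal{R}(K_{\aleph_0}, G)$: two players $P_1$ and $P_2$ alternately claim previously unclaimed edges of the complete graph $K_{\aleph_0}$ on a countably infinite vertex set, $P_1$ moving first; the first player to claim all edges of a copy of the finite graph $G$ in their own color wins, and if nobody does so in finitely many moves the game is a draw. For $t\in\mathbb{N}$, $\hat{K}_{2,t}$ is $K_{2,t}$ together with the edge joining the two vertices of the part of size $2$. A player has a threat if they have claimed all edges of a copy $H$ of $\hat{K}_{2,3}-e$ for some edge $e$ of $\hat{K}_{2,3}$ such that the board edge corresponding to $e$ (completing $H$ to a copy of $\hat{K}_{2,3}$) is not yet claimed by either player. -}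

module Defs where

open import Data.Nat using (ℕ; _≤_)
open import Data.Product using (_×_; _,_; proj₁; proj₂; Σ; ∃; ∃-syntax)
open import Data.Sum using (_⊎_)
open import Data.List using (List; []; _∷_; length)
open import Data.List.Relation.Unary.All using (All)
open import Data.List.Membership.Propositional using (_∈_)
open import Relation.Binary.PropositionalEquality using (_≡_; _≢_)
open import Relation.Nullary using (¬_)

-- Board: K_ℵ₀ on vertex set ℕ.  An edge {u,v} (u ≢ v) is recorded as an
-- ordered pair (u , v); orientation is irrelevant (see Claimed).
Edge : Set
Edge = ℕ × ℕ

EdgeSet : Set
EdgeSet = List Edge

Claimed : EdgeSet → ℕ → ℕ → Set
Claimed S u v = ((u , v) ∈ S) ⊎ ((v , u) ∈ S)

ClaimedE : EdgeSet → Edge → Set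
ClaimedE S e = Claimed S (proj₁ e) (proj₂ e)

data ValidSet : EdgeSet → Set where
  []  : ValidSet []
  _∷_ : ∀ {u v S} → (u ≢ v) × ¬ Claimed S u v → ValidSet S → ValidSet ((u , v) ∷ S)

record Position : Set where
  constructor pos
  field
    red  : EdgeSet   -- claimed by P1
    blue : EdgeSet   -- claimed by P2
open Position public

Unclaimed : Position → ℕ → ℕ → Set
Unclaimed p u v = (u ≢ v) × ¬ Claimed (red p) u v × ¬ Claimed (blue p) u v

Distinct4 : ℕ → ℕ → ℕ → ℕ → Set
Distinct4 a b c d = a ≢ b × a ≢ c × a ≢ d × b ≢ c × b ≢ d × c ≢ d

Distinct5 : ℕ → ℕ → ℕ → ℕ → ℕ → Set
Distinct5 a b c d e = Distinct4 a b c d × a ≢ e × b ≢ e × c ≢ e × d ≢ e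

K22hatEdges : ℕ → ℕ → ℕ → ℕ → List Edge
K22hatEdges a b c1 c2 =
  (a , b) ∷ (a , c1) ∷ (a , c2) ∷ (b , c1) ∷ (b , c2) ∷ []

K23hatEdges : ℕ → ℕ → ℕ → ℕ → ℕ → List Edge
K23hatEdges a b c1 c2 c3 =
  (a , b) ∷ (a , c1) ∷ (a , c2) ∷ (a , c3) ∷ (b , c1) ∷ (b , c2) ∷ (b , c3) ∷ []

HasK22hat : EdgeSet → Set
HasK22hat S = ∃[ a ] ∃[ b ] ∃[ c1 ] ∃[ c2 ]
  (Distinct4 a b c1 c2 × All (ClaimedE S) (K22hatEdges a b c1 c2))

HasK23hat : EdgeSet → Set
HasK23hat S = ∃[ a ] ∃[ b ] ∃[ c1 ] ∃[ c2 ] ∃[ c3 ]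
  (Distinct5 a b c1 c2 c3 × All (ClaimedE S) (K23hatEdges a b c1 c2 c3))

P2Threat : Position → Set
P2Threat p = ∃[ a ] ∃[ b ] ∃[ c1 ] ∃[ c2 ] ∃[ c3 ]
  (Distinct5 a b c1 c2 c3 ×
   Σ Edge λ e → (e ∈ K23hatEdges a b c1 c2 c3) ×
     All (λ f → f ≡ e ⊎ ClaimedE (blue p) f) (K23hatEdges a b c1 c2 c3) ×
     Unclaimed p (proj₁ e) (proj₂ e))

-- A legal position with P1 to move: both colour classes are sets of genuine
-- edges, they are disjoint, both players made the same number of moves, and
-- the game has not ended (nobody owns a copy of K̂_{2,3}).
LegalP1ToMove : Position → Set
LegalP1ToMove p =
  ValidSet (red p) × ValidSet (blue p) ×
  (∀ u v → Claimed (red p) u v → ¬ Claimed (blue p) u v) ×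
  length (red p) ≡ length (blue p) ×
  ¬ HasK23hat (red p) × ¬ HasK23hat (blue p)

-- P1 (to move) has a winning strategy in R(K_ℵ₀, K̂_{2,3}) from p:
-- the well-founded (inductive) notion — P1 can force a win in finitely many
-- moves.
data P1Wins (p : Position) : Set where
  win-now : ∀ u v → Unclaimed p u v →
            HasK23hat ((u , v) ∷ red p) → P1Wins p
  play    : ∀ u v → Unclaimed p u v →
            (∀ x y → Unclaimed (pos ((u , v) ∷ red p) (blue p)) x y →
               ¬ HasK23hat ((x , y) ∷ blue p) ×
               P1Wins (pos ((u , v) ∷ red p) ((x , y) ∷ blue p))) →
            P1Wins p

{-# OPTIONS --safe #-}
-- Let the red K̂₂,₂ have parts {g , h} and {c₁ , c₂}, named so that blue has no K̂₂,₂ whose 2-part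
-- contains h (if both vertices of the red 2-part failed, blue would need 8 distinct edges).
-- Three times P1 claims g w for a new vertex w, threatening h w, so P2 must claim h w; a pendant
-- blue edge at h creates no blue threat precisely because blue has no K̂₂,₂ at h.  With g now
-- adjacent to new vertices x, y, z, P1 claims c₁ x and threatens both c₁ y and c₁ z.  As P2 never
-- has a threat, no forced reply of P2 completes a blue K̂₂,₃.
module Submission where

open import Defs
open import Data.Nat using (ℕ; suc; _≤_; _<_; _≟_; _⊔_; z≤n; s≤s)
open import Data.Nat.Properties
  using (≤-trans; m≤m⊔n; m≤n⊔m; m≤n⇒m≤o⊔n; <⇒≱; ≤⇒≯; anyUpTo?; module ≤-Reasoning)
open import Data.List using (List; []; _∷_; length; map; _++_)
open import Data.List.Properties using (length-removeAt′)
open import Data.List.Relation.Unary.All as All using (All; []; _∷_)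
import Data.List.Relation.Unary.All.Properties as Allₚ
open import Data.List.Relation.Unary.AllPairs as AllPairs using (AllPairs; []; _∷_)
import Data.List.Relation.Unary.AllPairs.Properties as AllPairsₚ
open import Data.List.Relation.Unary.Any using (here; there; index; _─_)
open import Data.List.Membership.Propositional using (_∈_)
open import Data.Product using (_×_; _,_; proj₁; proj₂; ∃-syntax)
open import Data.Product.Properties using (≡-dec)
open import Data.List.Membership.DecPropositional (≡-dec _≟_ _≟_) using (_∈?_)
open import Data.Sum as Sum using (_⊎_; inj₁; inj₂; [_,_])
open import Data.Empty using (⊥; ⊥-elim)
open import Function using (_∘_)
open import Relation.Nullary using (¬_; Dec; yes; no)
open import Relation.Nullary.Decidable using (_×-dec_; _⊎-dec_; ¬?; map′)
open import Relation.Binary.PropositionalEquality using (_≡_; _≢_; refl; sym; cong; ≢-sym)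

infix 4 _≈_ _≉_ _⊆ᶜ_

data _≈_ : Edge → Edge → Set where
  ≈-refl : ∀ {e} → e ≈ e
  ≈-flip : ∀ {u v} → (u , v) ≈ (v , u)

_≉_ : Edge → Edge → Set
e ≉ f = ¬ e ≈ f

≈-sym : ∀ {e f} → e ≈ f → f ≈ e
≈-sym ≈-refl = ≈-refl
≈-sym ≈-flip = ≈-flip

≈-trans : ∀ {e f g} → e ≈ f → f ≈ g → e ≈ g
≈-trans ≈-refl f≈g    = f≈g
≈-trans ≈-flip ≈-refl = ≈-flip
≈-trans ≈-flip ≈-flip = ≈-refl

_≈?_ : ∀ e f → Dec (e ≈ f)
(u , v) ≈? (p , q) = map′ to from ((u ≟ p ×-dec v ≟ q) ⊎-dec (u ≟ q ×-dec v ≟ p))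
  where
  to : (u ≡ p × v ≡ q) ⊎ (u ≡ q × v ≡ p) → (u , v) ≈ (p , q)
  to (inj₁ (refl , refl)) = ≈-refl
  to (inj₂ (refl , refl)) = ≈-flip
  from : (u , v) ≈ (p , q) → (u ≡ p × v ≡ q) ⊎ (u ≡ q × v ≡ p)
  from ≈-refl = inj₁ (refl , refl)
  from ≈-flip = inj₂ (refl , refl)

≉-sym : ∀ {e f} → e ≉ f → f ≉ e
≉-sym e≉f = e≉f ∘ ≈-sym

≉-fst : ∀ {u v p q} → u ≢ p → u ≢ q → (u , v) ≉ (p , q)
≉-fst u≢p u≢q ≈-refl = u≢p refl
≉-fst u≢p u≢q ≈-flip = u≢q refl

≉-snd : ∀ {u v p q} → v ≢ p → v ≢ q → (u , v) ≉ (p , q)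
≉-snd v≢p v≢q ≈-refl = v≢q refl
≉-snd v≢p v≢q ≈-flip = v≢p refl

≉-star : ∀ {v w w'} → w ≢ w' → (v , w) ≉ (v , w')
≉-star w≢w' ≈-refl = w≢w' refl
≉-star w≢w' ≈-flip = w≢w' refl

claimed⇒∈≈ : ∀ {S u v} → Claimed S u v → ∃[ e ] (e ∈ S × (u , v) ≈ e)
claimed⇒∈≈ (inj₁ m) = _ , m , ≈-refl
claimed⇒∈≈ (inj₂ m) = _ , m , ≈-flip

∈≈⇒claimed : ∀ {S e u v} → e ∈ S → (u , v) ≈ e → Claimed S u v
∈≈⇒claimed m ≈-refl = inj₁ m
∈≈⇒claimed m ≈-flip = inj₂ m

claimed-swap : ∀ {S u v} → Claimed S u v → Claimed S v u
claimed-swap = Sum.swap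

claimed-there : ∀ {S e u v} → Claimed S u v → Claimed (e ∷ S) u v
claimed-there = Sum.map there there

claimed-∷⁺ : ∀ {S e u v} → (u , v) ≈ e → Claimed (e ∷ S) u v
claimed-∷⁺ = ∈≈⇒claimed (here refl)

claimed-here : ∀ {S u v} → Claimed ((u , v) ∷ S) u v
claimed-here = claimed-∷⁺ ≈-refl

claimed-∷⁻ : ∀ {S e u v} → Claimed (e ∷ S) u v → (u , v) ≈ e ⊎ Claimed S u v
claimed-∷⁻ c with claimed⇒∈≈ c
... | _ , here refl , uv≈e = inj₁ uv≈e
... | _ , there m   , uv≈e = inj₂ (∈≈⇒claimed m uv≈e)

claimed? : ∀ S u v → Dec (Claimed S u v)
claimed? S u v = ((u , v) ∈? S) ⊎-dec ((v , u) ∈? S)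

_⊆ᶜ_ : EdgeSet → EdgeSet → Set
S ⊆ᶜ S' = ∀ {u v} → Claimed S u v → Claimed S' u v

∷-mono-⊆ᶜ : ∀ {S S' e} → S ⊆ᶜ S' → (e ∷ S) ⊆ᶜ (e ∷ S')
∷-mono-⊆ᶜ S⊆S' = [ claimed-∷⁺ , claimed-there ∘ S⊆S' ] ∘ claimed-∷⁻

≈⇒∷-⊆ᶜ : ∀ {S e f} → e ≈ f → (e ∷ S) ⊆ᶜ (f ∷ S)
≈⇒∷-⊆ᶜ e≈f = [ claimed-∷⁺ ∘ (λ uv≈e → ≈-trans uv≈e e≈f) , claimed-there ] ∘ claimed-∷⁻

HasK23hat-mono : ∀ {S S'} → S ⊆ᶜ S' → HasK23hat S → HasK23hat S'
HasK23hat-mono S⊆S' (a , b , c₁ , c₂ , c₃ , d , k) = a , b , c₁ , c₂ , c₃ , d , All.map S⊆S' k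

Isolated : EdgeSet → ℕ → Set
Isolated S w = ∀ {u} → ¬ Claimed S u w

isolated⇒≢ : ∀ {S u v w} → Isolated S w → Claimed S u v → v ≢ w
isolated⇒≢ iso c refl = iso c

bound : EdgeSet → ℕ
bound []            = 0
bound ((u , v) ∷ S) = u ⊔ v ⊔ bound S

∈⇒≤bound : ∀ {S u v} → (u , v) ∈ S → u ⊔ v ≤ bound S
∈⇒≤bound (here refl)                = m≤m⊔n _ _
∈⇒≤bound {(u' , v') ∷ _} (there m) = m≤n⇒m≤o⊔n (u' ⊔ v') (∈⇒≤bound m)

claimed⇒≤bound : ∀ {S u v} → Claimed S u v → v ≤ bound S
claimed⇒≤bound {u = u} {v} (inj₁ m) = ≤-trans (m≤n⊔m u v) (∈⇒≤bound m)
claimed⇒≤bound {u = u} {v} (inj₂ m) = ≤-trans (m≤m⊔n v u) (∈⇒≤bound m)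

bound<⇒isolated : ∀ {S w} → bound S < w → Isolated S w
bound<⇒isolated b<w c = <⇒≱ b<w (claimed⇒≤bound c)

cliqueEdges : List ℕ → List Edge
cliqueEdges []       = []
cliqueEdges (v ∷ vs) = map (v ,_) vs ++ cliqueEdges vs

cliqueEdges-All : ∀ {P : ℕ → Set} {vs} → All P vs →
  All (λ e → P (proj₁ e) × P (proj₂ e)) (cliqueEdges vs)
cliqueEdges-All []         = []
cliqueEdges-All (pv ∷ pvs) = Allₚ.++⁺ (Allₚ.map⁺ (All.map (pv ,_) pvs)) (cliqueEdges-All pvs)

≉-cliqueEdges : ∀ {v w vs} → All (v ≢_) vs → All ((v , w) ≉_) (cliqueEdges vs)
≉-cliqueEdges v∉vs = All.map (λ (v≢p , v≢q) → ≉-fst v≢p v≢q) (cliqueEdges-All v∉vs)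

cliqueEdges-≉ : ∀ {vs} → AllPairs _≢_ vs → AllPairs _≉_ (cliqueEdges vs)
cliqueEdges-≉ []             = []
cliqueEdges-≉ (v∉vs ∷ vs≢) =
  AllPairsₚ.++⁺ (AllPairsₚ.map⁺ (AllPairs.map ≉-star vs≢)) (cliqueEdges-≉ vs≢)
    (Allₚ.map⁺ (All.map (λ _ → ≉-cliqueEdges v∉vs) v∉vs))

distinct4⇒AllPairs : ∀ {a b c d} → Distinct4 a b c d → AllPairs _≢_ (a ∷ b ∷ c ∷ d ∷ [])
distinct4⇒AllPairs (a≢b , a≢c , a≢d , b≢c , b≢d , c≢d) =
  (a≢b ∷ a≢c ∷ a≢d ∷ []) ∷ (b≢c ∷ b≢d ∷ []) ∷ (c≢d ∷ []) ∷ [] ∷ []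

distinct5⇒AllPairs : ∀ {a b c d e} → Distinct5 a b c d e → AllPairs _≢_ (a ∷ b ∷ c ∷ d ∷ e ∷ [])
distinct5⇒AllPairs ((a≢b , a≢c , a≢d , b≢c , b≢d , c≢d) , a≢e , b≢e , c≢e , d≢e) =
  (a≢b ∷ a≢c ∷ a≢d ∷ a≢e ∷ []) ∷ (b≢c ∷ b≢d ∷ b≢e ∷ []) ∷ (c≢d ∷ c≢e ∷ []) ∷ (d≢e ∷ []) ∷ [] ∷ []

-- K22hatEdges a b c₁ c₂ and K23hatEdges a b c₁ c₂ c₃ are, definitionally, the first 5 resp. 7
-- edges of the clique on a ∷ b ∷ c₁ ∷ …; the first 3 are the edges at a.
K22hatEdges-≉ : ∀ {a b c₁ c₂} → Distinct4 a b c₁ c₂ → AllPairs _≉_ (K22hatEdges a b c₁ c₂)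
K22hatEdges-≉ d = AllPairsₚ.take⁺ 5 (cliqueEdges-≉ (distinct4⇒AllPairs d))

K23hatEdges-≉ : ∀ {a b c₁ c₂ c₃} → Distinct5 a b c₁ c₂ c₃ → AllPairs _≉_ (K23hatEdges a b c₁ c₂ c₃)
K23hatEdges-≉ d = AllPairsₚ.take⁺ 7 (cliqueEdges-≉ (distinct5⇒AllPairs d))

∈-─ : ∀ {e f : Edge} {S} (e∈S : e ∈ S) → f ∈ S → f ≡ e ⊎ f ∈ (S ─ e∈S)
∈-─ (here refl) (here refl) = inj₁ refl
∈-─ (here refl) (there f∈S) = inj₂ f∈S
∈-─ (there e∈S) (here refl) = inj₂ (here refl)
∈-─ (there e∈S) (there f∈S) = Sum.map₂ there (∈-─ e∈S f∈S)

distinct-claimed⇒length≤ : ∀ {S L} → AllPairs _≉_ L → All (ClaimedE S) L → length L ≤ length S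
distinct-claimed⇒length≤ [] [] = z≤n
distinct-claimed⇒length≤ {S} {f ∷ L} (f≉L ∷ L≉) (c ∷ cs) with claimed⇒∈≈ c
... | e , e∈S , f≈e = begin
  suc (length L)         ≤⟨ s≤s (distinct-claimed⇒length≤ L≉ (All.zipWith claimed-in-rest (f≉L , cs))) ⟩
  suc (length (S ─ e∈S)) ≡⟨ sym (length-removeAt′ S (index e∈S)) ⟩
  length S               ∎
  where
  open ≤-Reasoning
  claimed-in-rest : ∀ {g} → f ≉ g × ClaimedE S g → ClaimedE (S ─ e∈S) g
  claimed-in-rest (f≉g , c') with claimed⇒∈≈ c'
  ... | e' , e'∈S , g≈e' with ∈-─ e∈S e'∈S
  ... | inj₁ refl   = ⊥-elim (f≉g (≈-trans f≈e (≈-sym g≈e')))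
  ... | inj₂ e'∈S─e = ∈≈⇒claimed e'∈S─e g≈e'

K22hatOn : EdgeSet → ℕ → ℕ → ℕ → ℕ → Set
K22hatOn S a b c₁ c₂ = Distinct4 a b c₁ c₂ × All (ClaimedE S) (K22hatEdges a b c₁ c₂)

K22hatAt : EdgeSet → ℕ → Set
K22hatAt S a = ∃[ b ] ∃[ c₁ ] ∃[ c₂ ] K22hatOn S a b c₁ c₂

K22hatOn-swap : ∀ {S a b c₁ c₂} → K22hatOn S a b c₁ c₂ → K22hatOn S b a c₁ c₂
K22hatOn-swap ((a≢b , a≢c₁ , a≢c₂ , b≢c₁ , b≢c₂ , c₁≢c₂) , ab ∷ ac₁ ∷ ac₂ ∷ bc₁ ∷ bc₂ ∷ []) =
  (≢-sym a≢b , b≢c₁ , b≢c₂ , a≢c₁ , a≢c₂ , c₁≢c₂) , claimed-swap ab ∷ bc₁ ∷ bc₂ ∷ ac₁ ∷ ac₂ ∷ []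

K22hatOn? : ∀ S a b c₁ c₂ → Dec (K22hatOn S a b c₁ c₂)
K22hatOn? S a b c₁ c₂ =
  (¬? (a ≟ b) ×-dec ¬? (a ≟ c₁) ×-dec ¬? (a ≟ c₂) ×-dec ¬? (b ≟ c₁) ×-dec ¬? (b ≟ c₂) ×-dec ¬? (c₁ ≟ c₂))
  ×-dec All.all? (λ e → claimed? S (proj₁ e) (proj₂ e)) (K22hatEdges a b c₁ c₂)

-- The apex a of a copy is adjacent to the other three vertices, so they lie below suc (bound S).
K22hatAt? : ∀ S a → Dec (K22hatAt S a)
K22hatAt? S a =
  map′ forget-bounds bounded
    (anyUpTo? (λ b → anyUpTo? (λ c₁ → anyUpTo? (K22hatOn? S a b c₁) N) N) N)
  where
  N = suc (bound S)
  Bounded : Set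
  Bounded = ∃[ b ] (b < N × ∃[ c₁ ] (c₁ < N × ∃[ c₂ ] (c₂ < N × K22hatOn S a b c₁ c₂)))
  forget-bounds : Bounded → K22hatAt S a
  forget-bounds (b , _ , c₁ , _ , c₂ , _ , k) = b , c₁ , c₂ , k
  below : ∀ {v} → Claimed S a v → v < N
  below = s≤s ∘ claimed⇒≤bound
  bounded : K22hatAt S a → Bounded
  bounded (b , c₁ , c₂ , k@(_ , ab ∷ ac₁ ∷ ac₂ ∷ _)) = b , below ab , c₁ , below ac₁ , c₂ , below ac₂ , k

-- Five edges of the copy at a and the three edges of the copy at b that contain b are pairwise
-- different, since b is not a vertex of the copy at a.
K22hatAt-two-apexes : ∀ {B a b} → a ≢ b → ¬ Claimed B a b → K22hatAt B a → K22hatAt B b → 8 ≤ length B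
K22hatAt-two-apexes {B} {a} {b} a≢b ¬ab (v , c , c' , da , ka@(av ∷ ac ∷ ac' ∷ _)) (w , d , d' , db , kb) =
  distinct-claimed⇒length≤
    (AllPairsₚ.++⁺ (AllPairsₚ.take⁺ 3 (K22hatEdges-≉ db)) (K22hatEdges-≉ da) (star ∷ star ∷ star ∷ []))
    (Allₚ.++⁺ (Allₚ.take⁺ 3 kb) ka)
  where
  not-neighbour : ∀ {u} → Claimed B a u → b ≢ u
  not-neighbour au refl = ¬ab au
  star : ∀ {x} → All ((b , x) ≉_) (K22hatEdges a v c c')
  star = Allₚ.take⁺ 5 (≉-cliqueEdges
    (≢-sym a≢b ∷ not-neighbour av ∷ not-neighbour ac ∷ not-neighbour ac' ∷ []))

isolated⇒unclaimed : ∀ {R B u w} → Isolated R w → Isolated B w → u ≢ w → Unclaimed (pos R B) u w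
isolated⇒unclaimed R-w B-w u≢w = u≢w , R-w , B-w

unclaimed-swap : ∀ {p u v} → Unclaimed p u v → Unclaimed p v u
unclaimed-swap (u≢v , ¬red , ¬blue) = ≢-sym u≢v , ¬red ∘ claimed-swap , ¬blue ∘ claimed-swap

unclaimed-≈ : ∀ {p e f} → e ≈ f → Unclaimed p (proj₁ f) (proj₂ f) → Unclaimed p (proj₁ e) (proj₂ e)
unclaimed-≈ ≈-refl = λ free → free
unclaimed-≈ ≈-flip = unclaimed-swap

unclaimed-red∷ : ∀ {R B e u v} → (u , v) ≉ e → Unclaimed (pos R B) u v → Unclaimed (pos (e ∷ R) B) u v
unclaimed-red∷ uv≉e (u≢v , ¬red , ¬blue) = u≢v , [ uv≉e , ¬red ] ∘ claimed-∷⁻ , ¬blue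

unclaimed-blue∷ : ∀ {R B e u v} → (u , v) ≉ e → Unclaimed (pos R B) u v → Unclaimed (pos R (e ∷ B)) u v
unclaimed-blue∷ uv≉e (u≢v , ¬red , ¬blue) = u≢v , ¬red , [ uv≉e , ¬blue ] ∘ claimed-∷⁻

¬P2Threat-red∷ : ∀ {R B e} → ¬ P2Threat (pos R B) → ¬ P2Threat (pos (e ∷ R) B)
¬P2Threat-red∷ ¬threat (a , b , c₁ , c₂ , c₃ , d , f , f∈ , almost , (f≢ , ¬red , ¬blue)) =
  ¬threat (a , b , c₁ , c₂ , c₃ , d , f , f∈ , almost , (f≢ , ¬red ∘ claimed-there , ¬blue))

claimed-∷-split : ∀ {B t L} → AllPairs _≉_ L → All (ClaimedE (t ∷ B)) L →
  All (ClaimedE B) L ⊎ ∃[ e ] (e ∈ L × e ≈ t × All (λ f → f ≡ e ⊎ ClaimedE B f) L)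
claimed-∷-split [] [] = inj₁ []
claimed-∷-split {B} {t} {f ∷ L} (f≉L ∷ L≉) (c ∷ cs) with claimed-∷⁻ c
... | inj₁ f≈t = inj₂ (f , here refl , f≈t , inj₁ refl ∷ All.zipWith only-f (f≉L , cs))
  where
  only-f : ∀ {g} → f ≉ g × ClaimedE (t ∷ B) g → g ≡ f ⊎ ClaimedE B g
  only-f (f≉g , c') = Sum.map₁ (λ g≈t → ⊥-elim (f≉g (≈-trans f≈t (≈-sym g≈t)))) (claimed-∷⁻ c')
... | inj₂ c' = Sum.map (c' ∷_) (λ (e , e∈L , e≈t , almost) → e , there e∈L , e≈t , inj₂ c' ∷ almost)
                        (claimed-∷-split L≉ cs)

¬P2Threat⇒reply-¬HasK23hat : ∀ {R B s t} → ¬ P2Threat (pos R B) → ¬ HasK23hat B →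
  Unclaimed (pos R B) s t → ¬ HasK23hat ((s , t) ∷ B)
¬P2Threat⇒reply-¬HasK23hat ¬threat ¬k st-free (a , b , c₁ , c₂ , c₃ , d , k)
  with claimed-∷-split (K23hatEdges-≉ d) k
... | inj₁ k' = ¬k (a , b , c₁ , c₂ , c₃ , d , k')
... | inj₂ (e , e∈ , e≈st , almost) =
  ¬threat (a , b , c₁ , c₂ , c₃ , d , e , e∈ , almost , unclaimed-≈ e≈st st-free)

three-in-two : ∀ {p q w₁ w₂ w₃ : ℕ} → w₁ ≢ w₂ → w₁ ≢ w₃ → w₂ ≢ w₃ →
  w₁ ≡ p ⊎ w₁ ≡ q → w₂ ≡ p ⊎ w₂ ≡ q → w₃ ≡ p ⊎ w₃ ≡ q → ⊥
three-in-two w₁≢w₂ _ _ (inj₁ refl) (inj₁ refl) _ = w₁≢w₂ refl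
three-in-two _ w₁≢w₃ _ (inj₁ refl) (inj₂ refl) (inj₁ refl) = w₁≢w₃ refl
three-in-two _ _ w₂≢w₃ (inj₁ refl) (inj₂ refl) (inj₂ refl) = w₂≢w₃ refl
three-in-two _ _ w₂≢w₃ (inj₂ refl) (inj₁ refl) (inj₁ refl) = w₂≢w₃ refl
three-in-two _ w₁≢w₃ _ (inj₂ refl) (inj₁ refl) (inj₂ refl) = w₁≢w₃ refl
three-in-two w₁≢w₂ _ _ (inj₂ refl) (inj₂ refl) _ = w₁≢w₂ refl

-- The leaf x of h cannot lie on a copy of K̂₂,₂, nor on a copy of K̂₂,₃ minus one edge except as
-- a vertex of the 3-part on the missing edge; then the rest of that copy is a K̂₂,₂ with apex h.
module PendantEdge {B : EdgeSet} {h x : ℕ} (h≢x : h ≢ x) (x-isolated : Isolated B x) where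

  leaf-neighbour : ∀ {u} → Claimed ((h , x) ∷ B) u x → u ≡ h
  leaf-neighbour c with claimed-∷⁻ c
  ... | inj₁ ≈-refl = refl
  ... | inj₁ ≈-flip = refl
  ... | inj₂ c'     = ⊥-elim (x-isolated c')

  leaf-off : ∀ {u v} → u ≢ x → v ≢ x → Claimed ((h , x) ∷ B) u v → Claimed B u v
  leaf-off u≢x v≢x c with claimed-∷⁻ c
  ... | inj₁ ≈-refl = ⊥-elim (v≢x refl)
  ... | inj₁ ≈-flip = ⊥-elim (u≢x refl)
  ... | inj₂ c'     = c'

  leaf-in-2-part : ∀ {e c} → (x , c) ≡ e ⊎ Claimed ((h , x) ∷ B) x c → c ≡ proj₂ e ⊎ c ≡ h
  leaf-in-2-part = [ inj₁ ∘ cong proj₂ , inj₂ ∘ leaf-neighbour ∘ claimed-swap ]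

  K22hat-off-leaf : ∀ {a b c c' p} → Distinct5 a b c c' x →
    All (λ f → f ≡ (p , x) ⊎ ClaimedE ((h , x) ∷ B) f) (K22hatEdges a b c c') →
    All (ClaimedE B) (K22hatEdges a b c c')
  K22hat-off-leaf (_ , a≢x , b≢x , c≢x , c'≢x) almost =
    All.zipWith (λ ((u≢x , v≢x) , f) → [ ⊥-elim ∘ v≢x ∘ cong proj₂ , leaf-off u≢x v≢x ] f)
      (Allₚ.take⁺ 5 (cliqueEdges-All (a≢x ∷ b≢x ∷ c≢x ∷ c'≢x ∷ [])) , almost)

  leaf-in-3-part : ∀ {a b c c' e} → Distinct5 a b c c' x →
    (a , x) ≡ e ⊎ Claimed ((h , x) ∷ B) a x → (b , x) ≡ e ⊎ Claimed ((h , x) ∷ B) b x →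
    All (λ f → f ≡ e ⊎ ClaimedE ((h , x) ∷ B) f) (K22hatEdges a b c c') → K22hatAt B h
  leaf-in-3-part {a} {b} {c} {c'} d5@(d , _) ax bx rest
    with Sum.map₂ leaf-neighbour ax | Sum.map₂ leaf-neighbour bx
  ... | inj₁ refl | inj₁ bx≡ax = ⊥-elim (proj₁ d (sym (cong proj₁ bx≡ax)))
  ... | inj₂ refl | inj₂ refl  = ⊥-elim (proj₁ d refl)
  ... | inj₁ refl | inj₂ refl  = a , c , c' , K22hatOn-swap (d , K22hat-off-leaf d5 rest)
  ... | inj₂ refl | inj₁ refl  = b , c , c' , d , K22hat-off-leaf d5 rest

  ¬K22hatAt-preserved : ¬ K22hatAt B h → ¬ K22hatAt ((h , x) ∷ B) h
  ¬K22hatAt-preserved ¬k (v , c , c' , d@(h≢v , h≢c , _ , _ , _ , _) , k@(_ ∷ _ ∷ _ ∷ vc ∷ vc' ∷ []))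
    with v ≟ x | c ≟ x | c' ≟ x
  ... | yes refl | _        | _         = h≢c (sym (leaf-neighbour (claimed-swap vc)))
  ... | no _     | yes refl | _         = h≢v (sym (leaf-neighbour vc))
  ... | no _     | no _     | yes refl  = h≢v (sym (leaf-neighbour vc'))
  ... | no v≢x   | no c≢x   | no c'≢x   =
    ¬k (v , c , c' , d , All.zipWith (λ ((u≢x , w≢x) , f) → leaf-off u≢x w≢x f)
                           (Allₚ.take⁺ 5 (cliqueEdges-All (h≢x ∷ v≢x ∷ c≢x ∷ c'≢x ∷ [])) , k))

  ¬P2Threat-preserved : ∀ {R} → ¬ K22hatAt B h → ¬ P2Threat (pos R B) → ¬ P2Threat (pos R ((h , x) ∷ B))
  ¬P2Threat-preserved ¬k ¬threat
    (a , b , c₁ , c₂ , c₃ , d@((a≢b , a≢c₁ , a≢c₂ , b≢c₁ , b≢c₂ , c₁≢c₂) , a≢c₃ , b≢c₃ , c₁≢c₃ , c₂≢c₃) ,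
     e , e∈ , almost@(ab ∷ ac₁ ∷ ac₂ ∷ ac₃ ∷ bc₁ ∷ bc₂ ∷ bc₃ ∷ []) , (e≢ , ¬red , ¬blue))
    with a ≟ x | b ≟ x | c₁ ≟ x | c₂ ≟ x | c₃ ≟ x
  ... | yes refl | _ | _ | _ | _ =
    three-in-two c₁≢c₂ c₁≢c₃ c₂≢c₃ (leaf-in-2-part ac₁) (leaf-in-2-part ac₂) (leaf-in-2-part ac₃)
  ... | no _ | yes refl | _ | _ | _ =
    three-in-two c₁≢c₂ c₁≢c₃ c₂≢c₃ (leaf-in-2-part bc₁) (leaf-in-2-part bc₂) (leaf-in-2-part bc₃)
  ... | no _ | no _ | yes refl | _ | _ =
    ¬k (leaf-in-3-part ((a≢b , a≢c₂ , a≢c₃ , b≢c₂ , b≢c₃ , c₂≢c₃) , a≢c₁ , b≢c₁ , ≢-sym c₁≢c₂ , ≢-sym c₁≢c₃)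
                       ac₁ bc₁ (ab ∷ ac₂ ∷ ac₃ ∷ bc₂ ∷ bc₃ ∷ []))
  ... | no _ | no _ | no _ | yes refl | _ =
    ¬k (leaf-in-3-part ((a≢b , a≢c₁ , a≢c₃ , b≢c₁ , b≢c₃ , c₁≢c₃) , a≢c₂ , b≢c₂ , c₁≢c₂ , ≢-sym c₂≢c₃)
                       ac₂ bc₂ (ab ∷ ac₁ ∷ ac₃ ∷ bc₁ ∷ bc₃ ∷ []))
  ... | no _ | no _ | no _ | no _ | yes refl =
    ¬k (leaf-in-3-part ((a≢b , a≢c₁ , a≢c₂ , b≢c₁ , b≢c₂ , c₁≢c₂) , a≢c₃ , b≢c₃ , c₁≢c₃ , c₂≢c₃)
                       ac₃ bc₃ (ab ∷ ac₁ ∷ ac₂ ∷ bc₁ ∷ bc₂ ∷ []))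
  ... | no a≢x | no b≢x | no c₁≢x | no c₂≢x | no c₃≢x =
    ¬threat (a , b , c₁ , c₂ , c₃ , d , e , e∈ ,
             All.zipWith (λ ((u≢x , v≢x) , f) → Sum.map₂ (leaf-off u≢x v≢x) f)
               (Allₚ.take⁺ 7 (cliqueEdges-All (a≢x ∷ b≢x ∷ c₁≢x ∷ c₂≢x ∷ c₃≢x ∷ [])) , almost) ,
             (e≢ , ¬red , ¬blue ∘ claimed-there))

P1Wins-resp-blue : ∀ {R B B'} → B ⊆ᶜ B' → B' ⊆ᶜ B → P1Wins (pos R B) → P1Wins (pos R B')
P1Wins-resp-blue B⊆B' B'⊆B (win-now u v (u≢v , ¬red , ¬blue) wins) =
  win-now u v (u≢v , ¬red , ¬blue ∘ B'⊆B) wins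
P1Wins-resp-blue {R} {B} {B'} B⊆B' B'⊆B (play u v (u≢v , ¬red , ¬blue) replies) =
  play u v (u≢v , ¬red , ¬blue ∘ B'⊆B) replies'
  where
  replies' : ∀ s t → Unclaimed (pos ((u , v) ∷ R) B') s t →
    ¬ HasK23hat ((s , t) ∷ B') × P1Wins (pos ((u , v) ∷ R) ((s , t) ∷ B'))
  replies' s t (s≢t , ¬red' , ¬blue') with replies s t (s≢t , ¬red' , ¬blue' ∘ B⊆B')
  ... | ¬k , next =
    ¬k ∘ HasK23hat-mono (∷-mono-⊆ᶜ B'⊆B) , P1Wins-resp-blue (∷-mono-⊆ᶜ B⊆B') (∷-mono-⊆ᶜ B'⊆B) next

forcing : ∀ {R B} m₁ m₂ t₁ t₂ → ¬ P2Threat (pos R B) → ¬ HasK23hat B →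
  Unclaimed (pos R B) m₁ m₂ → Unclaimed (pos ((m₁ , m₂) ∷ R) B) t₁ t₂ →
  HasK23hat ((t₁ , t₂) ∷ (m₁ , m₂) ∷ R) →
  (¬ HasK23hat ((t₁ , t₂) ∷ B) → P1Wins (pos ((m₁ , m₂) ∷ R) ((t₁ , t₂) ∷ B))) →
  P1Wins (pos R B)
forcing {R} {B} m₁ m₂ t₁ t₂ ¬threat ¬k m-free t-free t-wins blocked =
  play m₁ m₂ m-free (λ s t st-free → safe st-free , answer s t)
  where
  safe : ∀ {s t} → Unclaimed (pos ((m₁ , m₂) ∷ R) B) s t → ¬ HasK23hat ((s , t) ∷ B)
  safe = ¬P2Threat⇒reply-¬HasK23hat (¬P2Threat-red∷ ¬threat) ¬k
  answer : ∀ s t → P1Wins (pos ((m₁ , m₂) ∷ R) ((s , t) ∷ B))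
  answer s t with (s , t) ≈? (t₁ , t₂)
  ... | yes st≈t = P1Wins-resp-blue (≈⇒∷-⊆ᶜ (≈-sym st≈t)) (≈⇒∷-⊆ᶜ st≈t) (blocked (safe t-free))
  ... | no st≉t  = win-now t₁ t₂ (unclaimed-blue∷ (≉-sym st≉t) t-free) t-wins

double-threat : ∀ {R B} m₁ m₂ t₁ t₂ t₁' t₂' → ¬ P2Threat (pos R B) → ¬ HasK23hat B →
  Unclaimed (pos R B) m₁ m₂ →
  Unclaimed (pos ((m₁ , m₂) ∷ R) B) t₁ t₂ → Unclaimed (pos ((m₁ , m₂) ∷ R) B) t₁' t₂' →
  (t₁' , t₂') ≉ (t₁ , t₂) →
  HasK23hat ((t₁ , t₂) ∷ (m₁ , m₂) ∷ R) → HasK23hat ((t₁' , t₂') ∷ (m₁ , m₂) ∷ R) →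
  P1Wins (pos R B)
double-threat m₁ m₂ t₁ t₂ t₁' t₂' ¬threat ¬k m-free t-free t'-free t'≉t t-wins t'-wins =
  forcing m₁ m₂ t₁ t₂ ¬threat ¬k m-free t-free t-wins
    (λ _ → win-now t₁' t₂' (unclaimed-blue∷ t'≉t t'-free) t'-wins)

K22hat+common-neighbour⇒K23hat : ∀ {S a b c₁ c₂ w} → Distinct5 a b c₁ c₂ w →
  All (ClaimedE S) (K22hatEdges a b c₁ c₂) → Claimed S a w → Claimed S b w → HasK23hat S
K22hat+common-neighbour⇒K23hat d (ab ∷ ac₁ ∷ ac₂ ∷ bc₁ ∷ bc₂ ∷ []) aw bw =
  _ , _ , _ , _ , _ , d , ab ∷ ac₁ ∷ ac₂ ∷ aw ∷ bc₁ ∷ bc₂ ∷ bw ∷ []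

-- Claiming c x creates two threats: c y and c z complete the K̂₂,₃ with parts {g , c} and
-- {h , x , y} resp. {h , x , z}.
fan-double-threat : ∀ {R B g c h x y z} → Distinct5 g c h x y → Distinct5 g c h x z → y ≢ z →
  All (ClaimedE R) ((g , c) ∷ (g , h) ∷ (c , h) ∷ (g , x) ∷ (g , y) ∷ (g , z) ∷ []) →
  Unclaimed (pos R B) c x → Unclaimed (pos R B) c y → Unclaimed (pos R B) c z →
  ¬ P2Threat (pos R B) → ¬ HasK23hat B → P1Wins (pos R B)
fan-double-threat {R} {g = g} {c} {h} {x} {y} {z} dy@(_ , _ , c≢y , _ , x≢y) dz@(_ , _ , c≢z , _ , x≢z) y≢z
  (gc ∷ gh ∷ ch ∷ gx ∷ gy ∷ gz ∷ []) cx-free cy-free cz-free ¬threat ¬k =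
  double-threat c x c y c z ¬threat ¬k cx-free
    (unclaimed-red∷ (≉-snd (≢-sym c≢y) (≢-sym x≢y)) cy-free)
    (unclaimed-red∷ (≉-snd (≢-sym c≢z) (≢-sym x≢z)) cz-free)
    (≉-snd (≢-sym c≢z) (≢-sym y≢z))
    (wins dy gy) (wins dz gz)
  where
  old : ∀ {w u v} → Claimed R u v → Claimed ((c , w) ∷ (c , x) ∷ R) u v
  old = claimed-there ∘ claimed-there
  wins : ∀ {w} → Distinct5 g c h x w → Claimed R g w → HasK23hat ((c , w) ∷ (c , x) ∷ R)
  wins d gw = K22hat+common-neighbour⇒K23hat d
    (old gc ∷ old gh ∷ old gx ∷ old ch ∷ claimed-there claimed-here ∷ []) (old gw) claimed-here

record Quiet (h : ℕ) (p : Position) : Set where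
  field
    no-threat    : ¬ P2Threat p
    no-K23hat    : ¬ HasK23hat (blue p)
    no-K22hat-at : ¬ K22hatAt (blue p) h

module Strategy {g h c₁ c₂ : ℕ} (distinct : Distinct4 g h c₁ c₂) where

  private
    g≢h : g ≢ h
    g≢h = let (g≢h , _) = distinct in g≢h
    c₁≢g : c₁ ≢ g
    c₁≢g = let (_ , g≢c₁ , _) = distinct in ≢-sym g≢c₁
    c₁≢h : c₁ ≢ h
    c₁≢h = let (_ , _ , _ , h≢c₁ , _) = distinct in ≢-sym h≢c₁

  grow : ∀ {R e} → All (ClaimedE R) (K22hatEdges g h c₁ c₂) → All (ClaimedE (e ∷ R)) (K22hatEdges g h c₁ c₂)
  grow = All.map claimed-there

  K22hat≢isolated : ∀ {R w} → All (ClaimedE R) (K22hatEdges g h c₁ c₂) → Isolated R w →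
    g ≢ w × h ≢ w × c₁ ≢ w × c₂ ≢ w
  K22hat≢isolated (gh ∷ gc₁ ∷ gc₂ ∷ _) R-w =
    isolated⇒≢ R-w (claimed-swap gh) , isolated⇒≢ R-w gh , isolated⇒≢ R-w gc₁ , isolated⇒≢ R-w gc₂

  forced-round : ∀ {R B} → All (ClaimedE R) (K22hatEdges g h c₁ c₂) → Quiet h (pos R B) →
    (∀ w → Isolated R w → Isolated B w → Quiet h (pos ((g , w) ∷ R) ((h , w) ∷ B)) →
      P1Wins (pos ((g , w) ∷ R) ((h , w) ∷ B))) →
    P1Wins (pos R B)
  forced-round {R} {B} k q continue =
    let (g≢w , h≢w , c₁≢w , c₂≢w) = K22hat≢isolated k R-w in
    forcing g w h w no-threat no-K23hat (isolated⇒unclaimed R-w B-w g≢w)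
      (unclaimed-red∷ (≉-fst (≢-sym g≢h) h≢w) (isolated⇒unclaimed R-w B-w h≢w))
      (K22hat+common-neighbour⇒K23hat (distinct , g≢w , h≢w , c₁≢w , c₂≢w)
         (grow (grow k)) (claimed-there claimed-here) claimed-here)
      (λ ¬k → continue w R-w B-w record
        { no-threat    = PendantEdge.¬P2Threat-preserved h≢w B-w no-K22hat-at (¬P2Threat-red∷ no-threat)
        ; no-K23hat    = ¬k
        ; no-K22hat-at = PendantEdge.¬K22hatAt-preserved h≢w B-w no-K22hat-at
        })
    where
    open Quiet q
    w : ℕ
    w = suc (bound R ⊔ bound B)
    R-w : Isolated R w
    R-w = bound<⇒isolated (s≤s (m≤m⊔n (bound R) (bound B)))
    B-w : Isolated B w
    B-w = bound<⇒isolated (s≤s (m≤n⊔m (bound R) (bound B)))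

  unclaimed-after-round : ∀ {R B w v} → c₁ ≢ w → Unclaimed (pos R B) c₁ v →
    Unclaimed (pos ((g , w) ∷ R) ((h , w) ∷ B)) c₁ v
  unclaimed-after-round c₁≢w =
    unclaimed-blue∷ (≉-fst c₁≢h c₁≢w) ∘ unclaimed-red∷ (≉-fst c₁≢g c₁≢w)

  endgame : ∀ {R B x y z} → All (ClaimedE R) (K22hatEdges g h c₁ c₂) →
    Isolated R x → Isolated B x →
    Isolated ((g , x) ∷ R) y → Isolated ((h , x) ∷ B) y →
    Isolated ((g , y) ∷ (g , x) ∷ R) z → Isolated ((h , y) ∷ (h , x) ∷ B) z →
    let R₃ = (g , z) ∷ (g , y) ∷ (g , x) ∷ R
        B₃ = (h , z) ∷ (h , y) ∷ (h , x) ∷ B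
    in ¬ P2Threat (pos R₃ B₃) → ¬ HasK23hat B₃ → P1Wins (pos R₃ B₃)
  endgame {R} {x = x} {y} {z} k@(gh ∷ gc₁ ∷ _ ∷ hc₁ ∷ _) R-x B-x R-y B-y R-z B-z =
    let (g≢x , h≢x , c₁≢x , _) = K22hat≢isolated k R-x
        (g≢y , h≢y , c₁≢y , _) = K22hat≢isolated (grow k) R-y
        (g≢z , h≢z , c₁≢z , _) = K22hat≢isolated (grow (grow k)) R-z
        gc₁h≢x = (≢-sym c₁≢g , g≢h , g≢x , c₁≢h , c₁≢x , h≢x)
    in
    fan-double-threat (gc₁h≢x , g≢y , c₁≢y , h≢y , x≢y) (gc₁h≢x , g≢z , c₁≢z , h≢z , x≢z) y≢z
      (old gc₁ ∷ old gh ∷ old (claimed-swap hc₁) ∷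
       claimed-there (claimed-there claimed-here) ∷ claimed-there claimed-here ∷ claimed-here ∷ [])
      (unclaimed-after-round c₁≢z (unclaimed-after-round c₁≢y
        (unclaimed-after-round c₁≢x (isolated⇒unclaimed R-x B-x c₁≢x))))
      (unclaimed-after-round c₁≢z (unclaimed-after-round c₁≢y (isolated⇒unclaimed R-y B-y c₁≢y)))
      (unclaimed-after-round c₁≢z (isolated⇒unclaimed R-z B-z c₁≢z))
    where
    old : ∀ {e₁ e₂ e₃ u v} → Claimed R u v → Claimed (e₁ ∷ e₂ ∷ e₃ ∷ R) u v
    old = claimed-there ∘ claimed-there ∘ claimed-there
    x≢y : x ≢ y
    x≢y = isolated⇒≢ R-y claimed-here
    x≢z : x ≢ z
    x≢z = isolated⇒≢ R-z (claimed-there claimed-here)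
    y≢z : y ≢ z
    y≢z = isolated⇒≢ R-z claimed-here

  strategy : ∀ {R B} → All (ClaimedE R) (K22hatEdges g h c₁ c₂) → Quiet h (pos R B) → P1Wins (pos R B)
  strategy k q =
    forced-round k q λ x R-x B-x q₁ →
    forced-round (grow k) q₁ λ y R-y B-y q₂ →
    forced-round (grow (grow k)) q₂ λ z R-z B-z q₃ →
    endgame k R-x B-x R-y B-y R-z B-z (Quiet.no-threat q₃) (Quiet.no-K23hat q₃)

lemma3p2 : (p : Position) → LegalP1ToMove p → HasK22hat (red p) →
    ¬ P2Threat p → length (blue p) ≤ 7 → P1Wins p
lemma3p2 (pos R B) (_ , _ , disjoint , _ , _ , ¬K23hat-B) (a , b , c₁ , c₂ , K22-ab@(d , k@(ab ∷ _)))
         ¬threat |B|≤7 =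
  choose-apex (K22hatAt? B b)
  where
  quiet : ∀ {h} → ¬ K22hatAt B h → Quiet h (pos R B)
  quiet ¬K22 = record { no-threat = ¬threat ; no-K23hat = ¬K23hat-B ; no-K22hat-at = ¬K22 }
  choose-apex : Dec (K22hatAt B b) → P1Wins (pos R B)
  choose-apex (no ¬K22-b) = Strategy.strategy d k (quiet ¬K22-b)
  choose-apex (yes K22-b) =
    let (d-ba , k-ba) = K22hatOn-swap K22-ab in
    Strategy.strategy d-ba k-ba
      (quiet λ K22-a → ≤⇒≯ |B|≤7 (K22hatAt-two-apexes (proj₁ d) (disjoint a b ab) K22-a K22-b))
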